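{- Let $D$ be a multidigraph whose underlying graph is a cycle of length $n\ge 3$. Suppose there exists a pair of adjacent vertices $\{u,v\}\subseteq V(D)$ such that either no edge of $D$ goes from $u$ to $v$ or no edge of $D$ goes from $v$ to $u$. Then $\mathrm{DT}(D)$ is vertex decomposable.
   Context: A multidigraph $D$ consists of finite sets $V(D)$, $E(D)$ and maps $s,t:E(D)\to V(D)$ (source, target). Its underlying graph is the simple undirected graph on $V(D)$ in which $u\ne v$ are adjacent iff there is at least one edge of $D$ between them. For $\sigma\subseteq E(D)$, $D[\sigma]$ is the multidigraph with edge set $\sigma$ and vertex set the endpoints of edges of $\sigma$. A directed cycle is a connected multidigraph without parallel edges (two distinct edges with equal source and equal target) in which every vertex has in-degree and out-degree $1$. A directed forest is a digraph (no parallel edges) with no directed cycles in which no two distinct edges share the same target. $\mathrm{DT}(D)$ is the simplicial complex on $E(D)$ whose faces are the $\sigma\subseteq E(D)$ with $D[\sigma]$ a directed forest. A simplicial complex $\Delta$ is vertex decomposable if it is a simplex (including the void complex and $\{\emptyset\}$), or there is a vertex $v$ with $\mathrm{lk}_\Delta(v)$ and $\mathrm{del}_\Delta(v)$ vertex decomposable and every facet of $\mathrm{del}_\Delta(v)$ a facet of $\Delta$. -}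

module Defs where

open import Level using (0ℓ)
open import Data.Nat using (ℕ; zero; suc; _≤_)
open import Data.Fin using (Fin; toℕ)
open import Data.Fin.Subset using (Subset; _∈_; _∉_; _⊆_; ⁅_⁆; _∪_)
open import Data.Fin.Permutation using (Permutation′; _⟨$⟩ʳ_)
open import Data.Product using (Σ; ∃; _×_; _,_)
open import Data.Sum using (_⊎_)
open import Data.Empty using (⊥)
open import Relation.Nullary using (¬_)
open import Relation.Binary.PropositionalEquality using (_≡_; _≢_)

record Multidigraph : Set where
  field
    nv : ℕ
    ne : ℕ
    src : Fin ne → Fin nv
    tgt : Fin ne → Fin nv

open Multidigraph public

module _ (D : Multidigraph) where

  Adjacent : Fin (nv D) → Fin (nv D) → Set
  Adjacent u v = u ≢ v ×
    ∃ λ e → (src D e ≡ u × tgt D e ≡ v) ⊎ (src D e ≡ v × tgt D e ≡ u)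

  VertexOf : Subset (ne D) → Fin (nv D) → Set
  VertexOf σ w = ∃ λ e → e ∈ σ × (src D e ≡ w ⊎ tgt D e ≡ w)

  NoParallel : Subset (ne D) → Set
  NoParallel σ = ∀ e f → e ∈ σ → f ∈ σ → e ≢ f →
    ¬ (src D e ≡ src D f × tgt D e ≡ tgt D f)

  data Conn (σ : Subset (ne D)) : Fin (nv D) → Fin (nv D) → Set where
    here : ∀ {x} → Conn σ x x
    fwd  : ∀ {x y} e → e ∈ σ → src D e ≡ x → Conn σ (tgt D e) y → Conn σ x y
    bwd  : ∀ {x y} e → e ∈ σ → tgt D e ≡ x → Conn σ (src D e) y → Conn σ x y

  DirectedCycle : Subset (ne D) → Set
  DirectedCycle τ =
    (∃ λ e → e ∈ τ) ×
    (∀ x y → VertexOf τ x → VertexOf τ y → Conn τ x y) ×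
    NoParallel τ ×
    (∀ w → VertexOf τ w →
       (∃ λ e → e ∈ τ × tgt D e ≡ w × (∀ f → f ∈ τ → tgt D f ≡ w → f ≡ e)) ×
       (∃ λ e → e ∈ τ × src D e ≡ w × (∀ f → f ∈ τ → src D f ≡ w → f ≡ e)))

  DirectedForest : Subset (ne D) → Set
  DirectedForest σ =
    NoParallel σ ×
    (¬ ∃ λ τ → τ ⊆ σ × DirectedCycle τ) ×
    (∀ e f → e ∈ σ → f ∈ σ → e ≢ f → tgt D e ≢ tgt D f)

Complex : ℕ → Set₁
Complex m = Subset m → Set

DT : (D : Multidigraph) → Complex (ne D)
DT D σ = DirectedForest D σ

module _ {m : ℕ} (Δ : Complex m) where

  link : Fin m → Complex m
  link v σ = v ∉ σ × Δ (σ ∪ ⁅ v ⁆)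

  deletion : Fin m → Complex m
  deletion v σ = v ∉ σ × Δ σ

  IsFacet : Subset m → Set
  IsFacet σ = Δ σ × (∀ τ → Δ τ → σ ⊆ τ → τ ≡ σ)

  -- a simplex: the void complex, or all subsets of some τ
  -- (τ empty gives {∅})
  IsSimplex : Set
  IsSimplex = (∀ σ → ¬ Δ σ) ⊎ (Σ (Subset m) λ τ → ∀ σ → (Δ σ → σ ⊆ τ) × (σ ⊆ τ → Δ σ))

data VertexDecomposable {m : ℕ} : Complex m → Set₁ where
  simplex : ∀ {Δ} → IsSimplex Δ → VertexDecomposable Δ
  shed    : ∀ {Δ} (v : Fin m) → Δ ⁅ v ⁆ →
            VertexDecomposable (link Δ v) →
            VertexDecomposable (deletion Δ v) →
            (∀ σ → IsFacet (deletion Δ v) σ → IsFacet Δ σ) →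
            VertexDecomposable Δ

CycSucc : (n : ℕ) → Fin n → Fin n → Set
CycSucc n i j = suc (toℕ i) ≡ toℕ j ⊎ (suc (toℕ i) ≡ n × toℕ j ≡ 0)

CycAdj : (n : ℕ) → Fin n → Fin n → Set
CycAdj n i j = CycSucc n i j ⊎ CycSucc n j i

UnderlyingIsCycle : Multidigraph → Set
UnderlyingIsCycle D = 3 ≤ nv D ×
  Σ (Permutation′ (nv D)) λ π → ∀ u v →
    (Adjacent D u v → CycAdj (nv D) (π ⟨$⟩ʳ u) (π ⟨$⟩ʳ v)) ×
    (CycAdj (nv D) (π ⟨$⟩ʳ u) (π ⟨$⟩ʳ v) → Adjacent D u v)

-- Put coordinates 0, …, n − 1 around the cycle so that no arc goes from 0 to n − 1. Every other non-loop
-- arc into the vertex t then comes forward from t − 1 (mod n) or backward from t + 1; give it block 2t or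
-- 2t + 1 respectively. A set of arcs is a directed forest exactly when it has no loop, no two of its arcs lie
-- in equal or adjacent blocks (that would be a repeated target or a 2-cycle), and it misses one of the even
-- blocks 0, 2, …, 2n − 2: a directed cycle cannot use a backward arc, so the only one left is the forward
-- cycle around D. Complexes of this kind, the sets of elements in pairwise non-adjacent blocks that miss a
-- block of a list O without consecutive entries, are vertex decomposable by induction on the available
-- elements, shedding an element of lowest block having a neighbour, or of lowest block outside O, or any
-- element when all blocks lie in O.

module Submission where

open import Defs
open import Data.Empty using (⊥; ⊥-elim)
open import Data.Fin using (Fin; toℕ; fromℕ<)
open import Data.Fin.Properties using (any?; toℕ<n; toℕ-injective) renaming (_≟_ to _≟ᶠ_)
open import Data.Fin.Permutation using (Permutation′; _⟨$⟩ʳ_; _⟨$⟩ˡ_; inverseˡ)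
open import Data.Fin.Subset using (Subset; _∈_; _∉_; _⊆_; _⊂_; ⁅_⁆; _∪_; _∩_; _─_; _-_)
open import Data.Fin.Subset.Properties
  using ( _∈?_; x∈⁅x⁆; x∈⁅y⁆⇒x≡y; x∈p∪q⁻; x∈p∪q⁺; p⊆p∪q; p─q⊆p; x∈p∧x∉q⇒x∈p─q; x∈p∧x≢y⇒x∈p-y
        ; x∈p⇒p-x⊂p; p∩q≢∅⇒p─q⊂p; x∈p∩q⁺; x∈p∩q⁻ )
open import Data.Fin.Subset.Induction using (⊂-wellFounded)
open import Induction.WellFounded using (Acc; acc)
open import Data.List using (List; []; _∷_; filter; applyUpTo)
open import Data.List.Membership.Propositional using (find; lose) renaming (_∈_ to _∈ₗ_; _∉_ to _∉ₗ_)
open import Data.List.Membership.Propositional.Properties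
  using (∈-filter⁺; ∈-filter⁻; ∈-applyUpTo⁺; ∈-applyUpTo⁻)
open import Data.List.Relation.Unary.Any using (here)
import Data.List.Relation.Unary.Any as Any
open import Data.Nat using (ℕ; zero; suc; pred; _∸_; _*_; z≤n; s≤s; _≤_; _<_; _<?_; _≟_)
open import Data.List.Membership.DecPropositional _≟_ using () renaming (_∈?_ to _∈ₗ?_)
open import Data.Nat.Induction using (<-wellFounded)
open import Data.Nat.Properties
  using ( ≤-refl; ≤-reflexive; ≤-trans; ≤-<-trans; <-trans; <-irrefl; ≮⇒≥; ≤-pred; suc[m]≤n⇒m≤pred[n]
        ; n≤1+n; n<1+n; 1+n≰n; 1+n≢n; m≤n⇒m<n∨m≡n; suc-injective
        ; +-∸-assoc; n∸n≡0; m∸n≤m; ∸-cancelˡ-≡; *-suc; *-cancelˡ-≡; even≢odd )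
open import Data.Product using (∃; _×_; _,_; proj₁; proj₂; map₂)
import Data.Sum as Sum
open import Data.Sum using (_⊎_; inj₁; inj₂)
open import Data.Vec using (_∷_; tabulate)
open import Data.Vec.Base using (there)
open import Data.Vec.Properties using (lookup∘tabulate; lookup⇒[]=; []=⇒lookup)
open import Function using (_∘_)
open import Relation.Binary.PropositionalEquality
  using (_≡_; _≢_; refl; sym; trans; cong; cong₂; subst; module ≡-Reasoning)
open ≡-Reasoning
open import Relation.Nullary using (¬_; Dec; yes; no; ¬?; does; contradiction)
open import Relation.Nullary.Decidable using (_×-dec_; _⊎-dec_; map′; decidable-stable; dec-true)
open import Relation.Unary using (Pred; Decidable; _≐_)
open import Relation.Unary.Properties using (≐-sym)

x∈p─q⇒x∉q : ∀ {n} {p q : Subset n} {x} → x ∈ p ─ q → x ∉ q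
x∈p─q⇒x∉q {p = _ ∷ _} {_ ∷ _} (there x∈p─q) (there x∈q) = x∈p─q⇒x∉q x∈p─q x∈q

module _ {m : ℕ} where

  x∈p∪⁅y⁆⁻ : ∀ {p : Subset m} {x y} → x ∈ p ∪ ⁅ y ⁆ → x ∈ p ⊎ x ≡ y
  x∈p∪⁅y⁆⁻ {p} {y = y} x∈ with x∈p∪q⁻ p ⁅ y ⁆ x∈
  ... | inj₁ x∈p = inj₁ x∈p
  ... | inj₂ x∈⁅y⁆ = inj₂ (x∈⁅y⁆⇒x≡y y x∈⁅y⁆)

  x∈p⇒x∈p∪⁅y⁆ : ∀ {p : Subset m} {x y} → x ∈ p → x ∈ p ∪ ⁅ y ⁆
  x∈p⇒x∈p∪⁅y⁆ = x∈p∪q⁺ ∘ inj₁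

  y∈p∪⁅y⁆ : ∀ {p : Subset m} {y} → y ∈ p ∪ ⁅ y ⁆
  y∈p∪⁅y⁆ {p} {y} = x∈p∪q⁺ {p = p} (inj₂ (x∈⁅x⁆ y))

  p∪⁅y⁆⊆q : ∀ {p q : Subset m} {y} → p ⊆ q → y ∈ q → p ∪ ⁅ y ⁆ ⊆ q
  p∪⁅y⁆⊆q p⊆q y∈q x∈ with x∈p∪⁅y⁆⁻ x∈
  ... | inj₁ x∈p = p⊆q x∈p
  ... | inj₂ refl = y∈q

  x∈p⇒⁅x⁆⊆p : ∀ {p : Subset m} {x} → x ∈ p → ⁅ x ⁆ ⊆ p
  x∈p⇒⁅x⁆⊆p {p} {x} x∈p y∈⁅x⁆ = subst (_∈ p) (sym (x∈⁅y⁆⇒x≡y x y∈⁅x⁆)) x∈p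

  minimal-witness : ∀ {ℓ} {P : Pred (Fin m) ℓ} → Decidable P → (g : Fin m → ℕ) → ∃ P →
    ∃ λ x → P x × ∀ {z} → P z → g x ≤ g z
  minimal-witness {P = P} P? g (x , px) = go x px (<-wellFounded (g x))
    where
    go : ∀ x → P x → Acc _<_ (g x) → ∃ λ x → P x × ∀ {z} → P z → g x ≤ g z
    go x px (acc smaller) with any? (λ z → P? z ×-dec g z <? g x)
    ... | yes (z , pz , gz<gx) = go z pz (smaller gz<gx)
    ... | no none = x , px , λ pz → ≮⇒≥ (λ gz<gx → none (_ , pz , gz<gx))

  select : ∀ {ℓ} {P : Pred (Fin m) ℓ} → Decidable P → Subset m
  select P? = tabulate (does ∘ P?)

  module _ {ℓ} {P : Pred (Fin m) ℓ} (P? : Decidable P) where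

    ∈-select⁺ : ∀ {x} → P x → x ∈ select P?
    ∈-select⁺ {x} px = lookup⇒[]= x (select P?) (trans (lookup∘tabulate (does ∘ P?) x) (dec-true (P? x) px))

    ∈-select⁻ : ∀ {x} → x ∈ select P? → P x
    ∈-select⁻ {x} x∈ with P? x | trans (sym (lookup∘tabulate (does ∘ P?) x)) ([]=⇒lookup x∈)
    ... | yes px | _ = px
    ... | no _ | ()

module _ {m : ℕ} where

  facet-resp-≐ : ∀ {Δ Δ′ : Complex m} → Δ ≐ Δ′ → ∀ σ → IsFacet Δ σ → IsFacet Δ′ σ
  facet-resp-≐ (to , from) σ (face , maximal) = to face , λ τ face′ → maximal τ (from face′)

  link-resp-≐ : ∀ {Δ Δ′ : Complex m} v → Δ ≐ Δ′ → link Δ v ≐ link Δ′ v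
  link-resp-≐ v (to , from) = map₂ to , map₂ from

  deletion-resp-≐ : ∀ {Δ Δ′ : Complex m} v → Δ ≐ Δ′ → deletion Δ v ≐ deletion Δ′ v
  deletion-resp-≐ v (to , from) = map₂ to , map₂ from

  vertexDecomposable-resp-≐ : ∀ {Δ Δ′ : Complex m} → Δ ≐ Δ′ → VertexDecomposable Δ → VertexDecomposable Δ′
  vertexDecomposable-resp-≐ (to , from) (simplex (inj₁ void)) = simplex (inj₁ λ σ → void σ ∘ from)
  vertexDecomposable-resp-≐ (to , from) (simplex (inj₂ (τ , faces))) =
    simplex (inj₂ (τ , λ σ → proj₁ (faces σ) ∘ from , to ∘ proj₂ (faces σ)))
  vertexDecomposable-resp-≐ Δ≐Δ′@(to , _) (shed v face lk del facets) =
    shed v (to face)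
      (vertexDecomposable-resp-≐ (link-resp-≐ v Δ≐Δ′) lk)
      (vertexDecomposable-resp-≐ (deletion-resp-≐ v Δ≐Δ′) del)
      λ σ → facet-resp-≐ Δ≐Δ′ σ ∘ facets σ ∘ facet-resp-≐ (≐-sym (deletion-resp-≐ v Δ≐Δ′)) σ

  DownClosed : Complex m → Set
  DownClosed Δ = ∀ {σ τ} → σ ⊆ τ → Δ τ → Δ σ

  -- The constructive form of "no face of lk v is a facet of del v".
  Shedding : Complex m → Fin m → Set
  Shedding Δ v = ∀ σ → Δ σ → v ∉ σ → Δ (σ ∪ ⁅ v ⁆) → ∃ λ y → y ∉ σ × y ≢ v × Δ (σ ∪ ⁅ y ⁆)

  shedding⇒deletion-facets : ∀ {Δ v} → DownClosed Δ → Shedding Δ v →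
    ∀ σ → IsFacet (deletion Δ v) σ → IsFacet Δ σ
  shedding⇒deletion-facets {Δ} {v} downClosed shedding σ ((v∉σ , face) , maximal) = face , maximalΔ
    where
    maximalΔ : ∀ τ → Δ τ → σ ⊆ τ → τ ≡ σ
    maximalΔ τ faceτ σ⊆τ with v ∈? τ
    ... | no v∉τ = maximal τ (v∉τ , faceτ) σ⊆τ
    ... | yes v∈τ with shedding σ face v∉σ (downClosed (p∪⁅y⁆⊆q σ⊆τ v∈τ) faceτ)
    ...   | y , y∉σ , y≢v , faceσy = contradiction (subst (y ∈_) σy≡σ y∈p∪⁅y⁆) y∉σ
      where
      v∉σy : v ∉ σ ∪ ⁅ y ⁆
      v∉σy v∈ with x∈p∪⁅y⁆⁻ v∈
      ... | inj₁ v∈σ = v∉σ v∈σ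
      ... | inj₂ v≡y = y≢v (sym v≡y)
      σy≡σ : σ ∪ ⁅ y ⁆ ≡ σ
      σy≡σ = maximal (σ ∪ ⁅ y ⁆) (v∉σy , faceσy) (p⊆p∪q ⁅ y ⁆)

-- Complexes of elements in pairwise non-adjacent blocks

Close : ℕ → ℕ → Set
Close a b = a ≡ b ⊎ suc a ≡ b ⊎ suc b ≡ a

close? : ∀ a b → Dec (Close a b)
close? a b = a ≟ b ⊎-dec suc a ≟ b ⊎-dec suc b ≟ a

close-sym : ∀ {a b} → Close a b → Close b a
close-sym (inj₁ a≡b) = inj₁ (sym a≡b)
close-sym (inj₂ (inj₁ 1+a≡b)) = inj₂ (inj₂ 1+a≡b)
close-sym (inj₂ (inj₂ 1+b≡a)) = inj₂ (inj₁ 1+b≡a)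

same-pair-close : ∀ {k a b} → a ≡ k ⊎ a ≡ suc k → b ≡ k ⊎ b ≡ suc k → Close a b
same-pair-close (inj₁ refl) (inj₁ refl) = inj₁ refl
same-pair-close (inj₁ refl) (inj₂ refl) = inj₂ (inj₁ refl)
same-pair-close (inj₂ refl) (inj₁ refl) = inj₂ (inj₂ refl)
same-pair-close (inj₂ refl) (inj₂ refl) = inj₁ refl

Sparse : List ℕ → Set
Sparse O = ∀ {j} → j ∈ₗ O → suc j ∉ₗ O

other-than? : ∀ j i → Dec (i ≢ j)
other-than? j i = ¬? (i ≟ j)

_without_ : List ℕ → ℕ → List ℕ
O without j = filter (other-than? j) O

∈-without⁺ : ∀ {O i j} → i ∈ₗ O → i ≢ j → i ∈ₗ O without j
∈-without⁺ {j = j} = ∈-filter⁺ (other-than? j)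

∈-without⁻ : ∀ {O i j} → i ∈ₗ O without j → i ∈ₗ O × i ≢ j
∈-without⁻ {j = j} = ∈-filter⁻ (other-than? j)

sparse-without : ∀ {O} j → Sparse O → Sparse (O without j)
sparse-without j sparse i∈ 1+i∈ = sparse (proj₁ (∈-without⁻ i∈)) (proj₁ (∈-without⁻ 1+i∈))

module Blocks {m : ℕ} (block : Fin m → ℕ) where

  Separated : Subset m → Set
  Separated σ = ∀ {e f} → e ∈ σ → f ∈ σ → e ≢ f → ¬ Close (block e) (block f)

  Independent : Subset m → Complex m
  Independent A σ = σ ⊆ A × Separated σ

  Hit : Subset m → ℕ → Set
  Hit σ j = ∃ λ e → e ∈ σ × block e ≡ j

  hit? : ∀ σ j → Dec (Hit σ j)
  hit? σ j = any? λ e → e ∈? σ ×-dec block e ≟ j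

  Misses : Subset m → List ℕ → Set
  Misses σ O = ∃ λ j → j ∈ₗ O × ¬ Hit σ j

  misses? : ∀ σ O → Dec (Misses σ O)
  misses? σ O = map′ find (λ (_ , j∈O , ¬hit) → lose j∈O ¬hit) (Any.any? (¬? ∘ hit? σ) O)

  NonCovering : Subset m → List ℕ → Complex m
  NonCovering A O σ = Independent A σ × Misses σ O

  Flanked : Subset m → List ℕ → Set
  Flanked A O = ∀ {e} → e ∈ A → block e ∉ₗ O → ∃ λ k → block e ≡ suc k × k ∈ₗ O × suc (suc k) ∈ₗ O

  near? : ∀ v e → Dec (Close (block e) (block v))
  near? v e = close? (block e) (block v)

  near : Fin m → Subset m
  near v = select (near? v)

  A─near⊂A : ∀ {A v} → v ∈ A → A ─ near v ⊂ A
  A─near⊂A {A} {v} v∈A = p∩q≢∅⇒p─q⊂p A (near v) (v , x∈p∩q⁺ (v∈A , ∈-select⁺ (near? v) (inj₁ refl)))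

  separated-antitone : ∀ {σ τ} → σ ⊆ τ → Separated τ → Separated σ
  separated-antitone σ⊆τ sep e∈σ f∈σ = sep (σ⊆τ e∈σ) (σ⊆τ f∈σ)

  misses-antitone : ∀ {σ τ O} → σ ⊆ τ → Misses τ O → Misses σ O
  misses-antitone σ⊆τ (j , j∈O , ¬hit) = j , j∈O , λ (e , e∈σ , e↦j) → ¬hit (e , σ⊆τ e∈σ , e↦j)

  independent-downClosed : ∀ {A} → DownClosed (Independent A)
  independent-downClosed σ⊆τ (τ⊆A , sep) = (τ⊆A ∘ σ⊆τ) , separated-antitone σ⊆τ sep

  nonCovering-downClosed : ∀ {A O} → DownClosed (NonCovering A O)
  nonCovering-downClosed σ⊆τ (ind , miss) = independent-downClosed σ⊆τ ind , misses-antitone σ⊆τ miss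

  singleton-independent : ∀ {A v} → v ∈ A → Independent A ⁅ v ⁆
  singleton-independent {v = v} v∈A =
    x∈p⇒⁅x⁆⊆p v∈A ,
    λ e∈ f∈ e≢f _ → e≢f (trans (x∈⁅y⁆⇒x≡y v e∈) (sym (x∈⁅y⁆⇒x≡y v f∈)))

  separated-extend : ∀ {σ y} → Separated σ → (∀ {f} → f ∈ σ → ¬ Close (block y) (block f)) →
    Separated (σ ∪ ⁅ y ⁆)
  separated-extend sep far e∈ f∈ e≢f with x∈p∪⁅y⁆⁻ e∈ | x∈p∪⁅y⁆⁻ f∈
  ... | inj₁ e∈σ | inj₁ f∈σ = sep e∈σ f∈σ e≢f
  ... | inj₁ e∈σ | inj₂ refl = far e∈σ ∘ close-sym
  ... | inj₂ refl | inj₁ f∈σ = far f∈σ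
  ... | inj₂ refl | inj₂ refl = contradiction refl e≢f

  separated-far : ∀ {σ v} → Separated (σ ∪ ⁅ v ⁆) → v ∉ σ → ∀ {f} → f ∈ σ → ¬ Close (block v) (block f)
  separated-far sep v∉σ f∈σ = sep y∈p∪⁅y⁆ (x∈p⇒x∈p∪⁅y⁆ f∈σ) λ where refl → v∉σ f∈σ

  deletion-independent : ∀ {A v} → deletion (Independent A) v ≐ Independent (A - v)
  deletion-independent =
    (λ (v∉σ , σ⊆A , sep) → (λ e∈σ → x∈p∧x≢y⇒x∈p-y (σ⊆A e∈σ) λ where refl → v∉σ e∈σ) , sep) ,
    (λ (σ⊆A-v , sep) → (λ v∈σ → x∈p─q⇒x∉q (σ⊆A-v v∈σ) (x∈⁅x⁆ _)) , (p─q⊆p _ _ ∘ σ⊆A-v) , sep)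

  link-independent : ∀ {A v} → v ∈ A → link (Independent A) v ≐ Independent (A ─ near v)
  link-independent {A} {v} v∈A = to , from
    where
    to : ∀ {σ} → link (Independent A) v σ → Independent (A ─ near v) σ
    to (v∉σ , σv⊆A , sep) =
      (λ e∈σ → x∈p∧x∉q⇒x∈p─q (σv⊆A (x∈p⇒x∈p∪⁅y⁆ e∈σ))
                 (separated-far sep v∉σ e∈σ ∘ close-sym ∘ ∈-select⁻ (near? v))) ,
      separated-antitone x∈p⇒x∈p∪⁅y⁆ sep
    from : ∀ {σ} → Independent (A ─ near v) σ → link (Independent A) v σ
    from (σ⊆A─near , sep) =
      (λ v∈σ → x∈p─q⇒x∉q (σ⊆A─near v∈σ) (∈-select⁺ (near? v) (inj₁ refl))) ,
      p∪⁅y⁆⊆q (p─q⊆p _ _ ∘ σ⊆A─near) v∈A ,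
      separated-extend sep (λ f∈σ → x∈p─q⇒x∉q (σ⊆A─near f∈σ) ∘ ∈-select⁺ (near? v) ∘ close-sym)

  deletion-nonCovering : ∀ {A O v} → deletion (NonCovering A O) v ≐ NonCovering (A - v) O
  deletion-nonCovering =
    (λ (v∉σ , ind , miss) → proj₁ deletion-independent (v∉σ , ind) , miss) ,
    (λ (ind , miss) → let v∉σ , ind′ = proj₂ deletion-independent ind in v∉σ , ind′ , miss)

  link-nonCovering : ∀ {A O v} → v ∈ A → link (NonCovering A O) v ≐ NonCovering (A ─ near v) (O without block v)
  link-nonCovering {A} {O} {v} v∈A = to , from
    where
    to : ∀ {σ} → link (NonCovering A O) v σ → NonCovering (A ─ near v) (O without block v) σ
    to (v∉σ , ind , j , j∈O , ¬hit) =
      proj₁ (link-independent v∈A) (v∉σ , ind) ,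
      j , ∈-without⁺ j∈O (λ where refl → ¬hit (v , y∈p∪⁅y⁆ , refl)) ,
      λ (e , e∈σ , e↦j) → ¬hit (e , x∈p⇒x∈p∪⁅y⁆ e∈σ , e↦j)
    from : ∀ {σ} → NonCovering (A ─ near v) (O without block v) σ → link (NonCovering A O) v σ
    from (ind , j , j∈O′ , ¬hit) with ∈-without⁻ j∈O′
    ... | j∈O , j≢v = let v∉σ , ind′ = proj₂ (link-independent v∈A) ind in
      v∉σ , ind′ , j , j∈O , λ (e , e∈ , e↦j) → case e∈ e↦j
      where
      case : ∀ {e} → e ∈ _ ∪ ⁅ v ⁆ → block e ≡ j → ⊥
      case e∈ e↦j with x∈p∪⁅y⁆⁻ e∈
      ... | inj₁ e∈σ = ¬hit (_ , e∈σ , e↦j)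
      ... | inj₂ refl = j≢v (sym e↦j)

  NeighbourAbove : Fin m → Fin m → Set
  NeighbourAbove v u = u ≢ v × (block u ≡ block v ⊎ block u ≡ suc (block v))

  Below : Subset m → Fin m → Set
  Below A v = v ∈ A × ∃ λ u → u ∈ A × NeighbourAbove v u

  below? : ∀ A → Decidable (Below A)
  below? A v = v ∈? A ×-dec any? λ u →
    u ∈? A ×-dec ¬? (u ≟ᶠ v) ×-dec (block u ≟ block v ⊎-dec block u ≟ suc (block v))

  ¬below⇒separated : ∀ {A} → ¬ ∃ (Below A) → Separated A
  ¬below⇒separated ¬below {e} {f} e∈A f∈A e≢f (inj₁ be≡bf) =
    ¬below (e , e∈A , f , f∈A , e≢f ∘ sym , inj₁ (sym be≡bf))
  ¬below⇒separated ¬below {e} {f} e∈A f∈A e≢f (inj₂ (inj₁ 1+be≡bf)) =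
    ¬below (e , e∈A , f , f∈A , e≢f ∘ sym , inj₂ (sym 1+be≡bf))
  ¬below⇒separated ¬below {e} {f} e∈A f∈A e≢f (inj₂ (inj₂ 1+bf≡be)) =
    ¬below (f , f∈A , e , e∈A , e≢f , inj₂ (sym 1+bf≡be))

  -- A face σ ∪ {u} can trade u for v, because v is the lowest element having a neighbour above it.
  lowest-below-shedding : ∀ {A v u} → v ∈ A → NeighbourAbove v u → (∀ {z} → Below A z → block v ≤ block z) →
    Shedding (Independent A) u
  lowest-below-shedding {A} {v} {u} v∈A (u≢v , up) lowest σ (σ⊆A , sep) u∉σ (_ , sepu) =
    v , v∉σ , u≢v ∘ sym , p∪⁅y⁆⊆q σ⊆A v∈A , separated-extend sep far-v
    where
    far-u : ∀ {f} → f ∈ σ → ¬ Close (block u) (block f)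
    far-u = separated-far sepu u∉σ
    u~ : ∀ {c} → block u ≡ block v ⊎ block u ≡ suc (block v) → block v ≡ c ⊎ suc (block v) ≡ c →
      Close (block u) c
    u~ (inj₁ bu≡bv) (inj₁ refl) = inj₁ bu≡bv
    u~ (inj₁ bu≡bv) (inj₂ refl) = inj₂ (inj₁ (cong suc bu≡bv))
    u~ (inj₂ bu≡1+bv) (inj₁ refl) = inj₂ (inj₂ (sym bu≡1+bv))
    u~ (inj₂ bu≡1+bv) (inj₂ refl) = inj₁ bu≡1+bv
    v∉σ : v ∉ σ
    v∉σ v∈σ = far-u v∈σ (u~ up (inj₁ refl))
    far-v : ∀ {f} → f ∈ σ → ¬ Close (block v) (block f)
    far-v f∈σ (inj₁ bv≡bf) = far-u f∈σ (u~ up (inj₁ bv≡bf))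
    far-v f∈σ (inj₂ (inj₁ 1+bv≡bf)) = far-u f∈σ (u~ up (inj₂ 1+bv≡bf))
    far-v {f} f∈σ (inj₂ (inj₂ 1+bf≡bv)) =
      1+n≰n (subst (_≤ block f) (sym 1+bf≡bv)
        (lowest (σ⊆A f∈σ , v , v∈A , (λ where refl → v∉σ f∈σ) , inj₂ (sym 1+bf≡bv))))

  independent-vertexDecomposable : ∀ A → VertexDecomposable (Independent A)
  independent-vertexDecomposable A = go A (⊂-wellFounded A)
    where
    go : ∀ A → Acc _⊂_ A → VertexDecomposable (Independent A)
    go A (acc rec) with any? (below? A)
    ... | no ¬below =
      simplex (inj₂ (A , λ σ → proj₁ , λ σ⊆A → σ⊆A , separated-antitone σ⊆A (¬below⇒separated ¬below)))
    ... | yes below with minimal-witness (below? A) block below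
    ...   | v , (v∈A , u , u∈A , above) , lowest =
      shed u (singleton-independent u∈A)
        (vertexDecomposable-resp-≐ (≐-sym (link-independent u∈A)) (go _ (rec (A─near⊂A u∈A))))
        (vertexDecomposable-resp-≐ (≐-sym deletion-independent) (go _ (rec (x∈p⇒p-x⊂p u∈A))))
        (shedding⇒deletion-facets independent-downClosed (lowest-below-shedding v∈A above lowest))

  flanked-antitone : ∀ {A B O} → B ⊆ A → Flanked A O → Flanked B O
  flanked-antitone B⊆A flanked = flanked ∘ B⊆A

  flanked-link : ∀ {A O v} → Flanked A O → Flanked (A ─ near v) (O without block v)
  flanked-link {A} {O} {v} flanked {e} e∈ be∉O′ =
    let k , be≡1+k , k∈O , 2+k∈O = flanked (p─q⊆p A (near v) e∈) be∉O
    in k , be≡1+k , ∈-without⁺ k∈O (k≢bv be≡1+k) , ∈-without⁺ 2+k∈O (2+k≢bv be≡1+k)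
    where
    e≁v : ¬ Close (block e) (block v)
    e≁v = x∈p─q⇒x∉q e∈ ∘ ∈-select⁺ (near? v)
    be∉O : block e ∉ₗ O
    be∉O be∈O = be∉O′ (∈-without⁺ be∈O (e≁v ∘ inj₁))
    k≢bv : ∀ {k} → block e ≡ suc k → k ≢ block v
    k≢bv be≡1+k k≡bv = e≁v (inj₂ (inj₂ (trans (cong suc (sym k≡bv)) (sym be≡1+k))))
    2+k≢bv : ∀ {k} → block e ≡ suc k → suc (suc k) ≢ block v
    2+k≢bv be≡1+k 2+k≡bv = e≁v (inj₂ (inj₁ (trans (cong suc be≡1+k) 2+k≡bv)))

  misses⇒nonCovering≐independent : ∀ {A O} → Misses A O → NonCovering A O ≐ Independent A
  misses⇒nonCovering≐independent missA = proj₁ , λ ind → ind , misses-antitone (proj₁ ind) missA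

  covering-vertex-removable : ∀ {A O v} → ¬ Misses ⁅ v ⁆ O → NonCovering A O ≐ NonCovering (A - v) O
  covering-vertex-removable ¬miss =
    (λ (ind , miss) → proj₁ deletion-nonCovering
      ((λ v∈σ → ¬miss (misses-antitone (x∈p⇒⁅x⁆⊆p v∈σ) miss)) , ind , miss)) ,
    proj₂ ∘ proj₂ deletion-nonCovering

  -- x is an element of lowest block outside O; it trades for an element w of the block just below it.
  flanked-shedding : ∀ {A O x w k} → Sparse O → x ∈ A → block x ≡ suc k → k ∈ₗ O → suc (suc k) ∈ₗ O →
    w ∈ A → block w ≡ k → (∀ {z} → z ∈ A → block z ∉ₗ O → block x ≤ block z) →
    Shedding (NonCovering A O) x
  flanked-shedding {A} {O} {x} {w} {k} sparse x∈A bx≡1+k k∈O 2+k∈O w∈A bw≡k lowest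
    σ ((σ⊆A , sep) , _) x∉σ ((_ , sepx) , _) =
    w , w∉σ , w≢x , (p∪⁅y⁆⊆q σ⊆A w∈A , separated-extend sep far-w) , suc (suc k) , 2+k∈O , ¬hit
    where
    far-x : ∀ {f} → f ∈ σ → ¬ Close (block x) (block f)
    far-x = separated-far sepx x∉σ
    w∉σ : w ∉ σ
    w∉σ w∈σ = far-x w∈σ (inj₂ (inj₂ (trans (cong suc bw≡k) (sym bx≡1+k))))
    w≢x : w ≢ x
    w≢x refl = 1+n≢n (trans (sym bx≡1+k) bw≡k)
    far-w : ∀ {f} → f ∈ σ → ¬ Close (block w) (block f)
    far-w f∈σ (inj₁ bw≡bf) =
      far-x f∈σ (inj₂ (inj₂ (trans (cong suc (trans (sym bw≡bf) bw≡k)) (sym bx≡1+k))))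
    far-w f∈σ (inj₂ (inj₁ 1+bw≡bf)) = far-x f∈σ (inj₁ (trans bx≡1+k (trans (cong suc (sym bw≡k)) 1+bw≡bf)))
    far-w {f} f∈σ (inj₂ (inj₂ 1+bf≡bw)) with block f ∈ₗ? O
    ... | yes bf∈O = sparse bf∈O (subst (_∈ₗ O) (sym (trans 1+bf≡bw bw≡k)) k∈O)
    ... | no bf∉O =
      1+n≰n (≤-trans (subst (_≤ block f) bx≡2+bf (lowest (σ⊆A f∈σ) bf∉O)) (n≤1+n (block f)))
      where
      bx≡2+bf : block x ≡ suc (suc (block f))
      bx≡2+bf = trans bx≡1+k (cong suc (sym (trans 1+bf≡bw bw≡k)))
    ¬hit : ¬ Hit (σ ∪ ⁅ w ⁆) (suc (suc k))
    ¬hit (e , e∈ , be≡2+k) with x∈p∪⁅y⁆⁻ e∈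
    ... | inj₁ e∈σ = far-x e∈σ (inj₂ (inj₁ (trans (cong suc bx≡1+k) (sym be≡2+k))))
    ... | inj₂ refl = 1+n≰n (≤-trans (≤-reflexive (trans (sym be≡2+k) bw≡k)) (n≤1+n k))

  -- When every block of A lies in O, a face σ ∪ {v} missing the block j of O trades v for an element of block j.
  covered-shedding : ∀ {A O v} → Sparse O → (∀ {e} → e ∈ A → block e ∈ₗ O) → (∀ {j} → j ∈ₗ O → Hit A j) →
    v ∈ A → Shedding (NonCovering A O) v
  covered-shedding {A} {O} {v} sparse inO hitA v∈A σ ((σ⊆A , sep) , _) v∉σ ((_ , sepv) , j , j∈O , ¬hit)
    with hitA j∈O
  ... | y , y∈A , by≡j =
    y , y∉σ , y≢v , (p∪⁅y⁆⊆q σ⊆A y∈A , separated-extend sep far-y) , block v , inO v∈A , ¬hit-v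
    where
    y∉σ : y ∉ σ
    y∉σ y∈σ = ¬hit (y , x∈p⇒x∈p∪⁅y⁆ y∈σ , by≡j)
    y≢v : y ≢ v
    y≢v refl = ¬hit (y , y∈p∪⁅y⁆ , by≡j)
    far-y : ∀ {f} → f ∈ σ → ¬ Close (block y) (block f)
    far-y f∈σ (inj₁ by≡bf) = ¬hit (_ , x∈p⇒x∈p∪⁅y⁆ f∈σ , trans (sym by≡bf) by≡j)
    far-y f∈σ (inj₂ (inj₁ 1+by≡bf)) = sparse (inO y∈A) (subst (_∈ₗ O) (sym 1+by≡bf) (inO (σ⊆A f∈σ)))
    far-y f∈σ (inj₂ (inj₂ 1+bf≡by)) = sparse (inO (σ⊆A f∈σ)) (subst (_∈ₗ O) (sym 1+bf≡by) (inO y∈A))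
    ¬hit-v : ¬ Hit (σ ∪ ⁅ y ⁆) (block v)
    ¬hit-v (e , e∈ , be≡bv) with x∈p∪⁅y⁆⁻ e∈
    ... | inj₁ e∈σ = separated-far sepv v∉σ e∈σ (inj₁ (sym be≡bv))
    ... | inj₂ refl = ¬hit (v , y∈p∪⁅y⁆ , trans (sym be≡bv) by≡j)

  outside? : ∀ A O → Decidable (λ x → x ∈ A × block x ∉ₗ O)
  outside? A O x = x ∈? A ×-dec ¬? (block x ∈ₗ? O)

  ¬misses⇒hit : ∀ {σ O} → ¬ Misses σ O → ∀ {j} → j ∈ₗ O → Hit σ j
  ¬misses⇒hit {σ} ¬miss {j} j∈O = decidable-stable (hit? σ j) λ ¬hit → ¬miss (j , j∈O , ¬hit)

  shedding-vertex : ∀ {A O j} → Sparse O → Flanked A O → (∀ {j} → j ∈ₗ O → Hit A j) → j ∈ₗ O →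
    ∃ λ v → v ∈ A × Shedding (NonCovering A O) v
  shedding-vertex {A} {O} sparse flanked hitA j∈O with any? (outside? A O)
  ... | yes outside =
    let x , (x∈A , bx∉O) , lowest = minimal-witness (outside? A O) block outside
        k , bx≡1+k , k∈O , 2+k∈O = flanked x∈A bx∉O
        w , w∈A , bw≡k = hitA k∈O
    in x , x∈A ,
       flanked-shedding sparse x∈A bx≡1+k k∈O 2+k∈O w∈A bw≡k (λ z∈A bz∉O → lowest (z∈A , bz∉O))
  ... | no ¬outside =
    let v , v∈A , _ = hitA j∈O
        inO : ∀ {e} → e ∈ A → block e ∈ₗ O
        inO {e} e∈A = decidable-stable (block e ∈ₗ? O) λ be∉O → ¬outside (e , e∈A , be∉O)
    in v , v∈A , covered-shedding sparse inO hitA v∈A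

  nonCovering-vertexDecomposable : ∀ A O → Sparse O → Flanked A O → VertexDecomposable (NonCovering A O)
  nonCovering-vertexDecomposable A = go A (⊂-wellFounded A)
    where
    go : ∀ A → Acc _⊂_ A → ∀ O → Sparse O → Flanked A O → VertexDecomposable (NonCovering A O)
    go A _ [] _ _ = simplex (inj₁ λ { _ (_ , _ , () , _) })
    go A (acc rec) O@(_ ∷ _) sparse flanked with misses? A O | any? (λ v → v ∈? A ×-dec ¬? (misses? ⁅ v ⁆ O))
    ... | yes missA | _ =
      vertexDecomposable-resp-≐ (≐-sym (misses⇒nonCovering≐independent missA)) (independent-vertexDecomposable A)
    ... | no _ | yes (v , v∈A , ¬miss) =
      vertexDecomposable-resp-≐ (≐-sym (covering-vertex-removable ¬miss))
        (go (A - v) (rec (x∈p⇒p-x⊂p v∈A)) O sparse (flanked-antitone (p─q⊆p A ⁅ v ⁆) flanked))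
    ... | no ¬missA | no ¬covering with shedding-vertex sparse flanked (¬misses⇒hit ¬missA) (here refl)
    ...   | v , v∈A , shedding =
      shed v
        (singleton-independent v∈A , decidable-stable (misses? ⁅ v ⁆ O) λ ¬miss → ¬covering (v , v∈A , ¬miss))
        (vertexDecomposable-resp-≐ (≐-sym (link-nonCovering v∈A))
          (go _ (rec (A─near⊂A v∈A)) _ (sparse-without (block v) sparse) (flanked-link flanked)))
        (vertexDecomposable-resp-≐ (≐-sym deletion-nonCovering)
          (go _ (rec (x∈p⇒p-x⊂p v∈A)) O sparse (flanked-antitone (p─q⊆p A ⁅ v ⁆) flanked)))
        (shedding⇒deletion-facets nonCovering-downClosed shedding)

-- Directed cycles

module _ (D : Multidigraph) where

  conn-trans : ∀ {τ x y z} → Conn D τ x y → Conn D τ y z → Conn D τ x z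
  conn-trans here q = q
  conn-trans (fwd e e∈τ se≡x p) q = fwd e e∈τ se≡x (conn-trans p q)
  conn-trans (bwd e e∈τ te≡x p) q = bwd e e∈τ te≡x (conn-trans p q)

  conn-sym : ∀ {τ x y} → Conn D τ x y → Conn D τ y x
  conn-sym here = here
  conn-sym (fwd e e∈τ refl p) = conn-trans (conn-sym p) (bwd e e∈τ refl here)
  conn-sym (bwd e e∈τ refl p) = conn-trans (conn-sym p) (fwd e e∈τ refl here)

  conn-edge : ∀ {τ e} → e ∈ τ → Conn D τ (src D e) (tgt D e)
  conn-edge {e = e} e∈τ = fwd e e∈τ refl here

  adjacent-sym : ∀ {x y} → Adjacent D x y → Adjacent D y x
  adjacent-sym (x≢y , e , endpoints) = x≢y ∘ sym , e , Sum.swap endpoints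

  NoArc : Fin (nv D) → Fin (nv D) → Set
  NoArc a b = ¬ ∃ λ e → src D e ≡ a × tgt D e ≡ b

  oriented-gap : ∀ {u v} → Adjacent D u v → NoArc u v ⊎ NoArc v u → ∃ λ a → ∃ λ b → Adjacent D a b × NoArc a b
  oriented-gap {u} {v} adj (inj₁ no-u→v) = u , v , adj , no-u→v
  oriented-gap {u} {v} adj (inj₂ no-v→u) = v , u , adjacent-sym adj , no-v→u

  directedCycle-out : ∀ {τ e} → DirectedCycle D τ → e ∈ τ → ∃ λ g → g ∈ τ × src D g ≡ tgt D e
  directedCycle-out {e = e} (_ , _ , _ , degrees) e∈τ =
    let g , g∈τ , sg≡te , _ = proj₂ (degrees (tgt D e) (e , e∈τ , inj₂ refl)) in g , g∈τ , sg≡te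

  directedCycle-intro : ∀ {τ} (hub : Fin (nv D)) → (∃ λ e → e ∈ τ) →
    (∀ {x} → VertexOf D τ x → Conn D τ hub x) →
    (∀ {e f} → e ∈ τ → f ∈ τ → tgt D e ≡ tgt D f → e ≡ f) →
    (∀ {e f} → e ∈ τ → f ∈ τ → src D e ≡ src D f → e ≡ f) →
    (∀ {w} → VertexOf D τ w → (∃ λ e → e ∈ τ × tgt D e ≡ w) × (∃ λ e → e ∈ τ × src D e ≡ w)) →
    DirectedCycle D τ
  directedCycle-intro hub nonempty reach tgt-injective src-injective degrees =
    nonempty ,
    (λ x y x∈ y∈ → conn-trans (conn-sym (reach x∈)) (reach y∈)) ,
    (λ e f e∈ f∈ e≢f (se≡sf , _) → e≢f (src-injective e∈ f∈ se≡sf)) ,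
    λ w w∈ → let (e , e∈ , te≡w) , (f , f∈ , sf≡w) = degrees w∈ in
      (e , e∈ , te≡w , λ g g∈ tg≡w → tgt-injective g∈ e∈ (trans tg≡w (sym te≡w))) ,
      (f , f∈ , sf≡w , λ g g∈ sg≡w → src-injective g∈ f∈ (trans sg≡w (sym sf≡w)))

  loop-directedCycle : ∀ {e} → src D e ≡ tgt D e → DirectedCycle D ⁅ e ⁆
  loop-directedCycle {e} loop =
    directedCycle-intro (src D e) (e , x∈⁅x⁆ e) (λ x∈ → subst (Conn D _ _) (sym (vertex x∈)) here)
      (λ g∈ h∈ _ → trans (only g∈) (sym (only h∈))) (λ g∈ h∈ _ → trans (only g∈) (sym (only h∈)))
      λ w∈ → (e , x∈⁅x⁆ e , trans (sym loop) (sym (vertex w∈))) , (e , x∈⁅x⁆ e , sym (vertex w∈))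
    where
    only : ∀ {g} → g ∈ ⁅ e ⁆ → g ≡ e
    only = x∈⁅y⁆⇒x≡y e
    vertex : ∀ {x} → VertexOf D ⁅ e ⁆ x → x ≡ src D e
    vertex (g , g∈ , inj₁ sg≡x) rewrite only g∈ = sym sg≡x
    vertex (g , g∈ , inj₂ tg≡x) rewrite only g∈ = trans (sym tg≡x) (sym loop)

  antiparallel-directedCycle : ∀ {e f} → src D e ≢ tgt D e → src D f ≡ tgt D e → tgt D f ≡ src D e →
    DirectedCycle D (⁅ e ⁆ ∪ ⁅ f ⁆)
  antiparallel-directedCycle {e} {f} nonloop sf≡te tf≡se =
    directedCycle-intro (src D e) (e , e∈τ) reach
      (λ g∈ h∈ → injective g∈ h∈ λ te≡tf → nonloop (sym (trans te≡tf tf≡se)))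
      (λ g∈ h∈ → injective g∈ h∈ λ se≡sf → nonloop (trans se≡sf sf≡te))
      degrees
    where
    τ : Subset (ne D)
    τ = ⁅ e ⁆ ∪ ⁅ f ⁆
    e∈τ : e ∈ τ
    e∈τ = x∈p⇒x∈p∪⁅y⁆ (x∈⁅x⁆ e)
    either : ∀ {g} → g ∈ τ → g ≡ e ⊎ g ≡ f
    either g∈ with x∈p∪⁅y⁆⁻ g∈
    ... | inj₁ g∈⁅e⁆ = inj₁ (x∈⁅y⁆⇒x≡y e g∈⁅e⁆)
    ... | inj₂ g≡f = inj₂ g≡f
    vertex : ∀ {x} → VertexOf D τ x → x ≡ src D e ⊎ x ≡ tgt D e
    vertex (g , g∈ , endpoint) with either g∈ | endpoint
    ... | inj₁ refl | inj₁ se≡x = inj₁ (sym se≡x)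
    ... | inj₁ refl | inj₂ te≡x = inj₂ (sym te≡x)
    ... | inj₂ refl | inj₁ sf≡x = inj₂ (trans (sym sf≡x) sf≡te)
    ... | inj₂ refl | inj₂ tf≡x = inj₁ (trans (sym tf≡x) tf≡se)
    reach : ∀ {x} → VertexOf D τ x → Conn D τ (src D e) x
    reach x∈ with vertex x∈
    ... | inj₁ refl = here
    ... | inj₂ refl = conn-edge e∈τ
    injective : ∀ {g h} {end : Fin (ne D) → Fin (nv D)} → g ∈ τ → h ∈ τ → end e ≢ end f → end g ≡ end h → g ≡ h
    injective g∈ h∈ e≁f eg≡eh with either g∈ | either h∈
    ... | inj₁ refl | inj₁ refl = refl
    ... | inj₁ refl | inj₂ refl = contradiction eg≡eh e≁f
    ... | inj₂ refl | inj₁ refl = contradiction (sym eg≡eh) e≁f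
    ... | inj₂ refl | inj₂ refl = refl
    degrees : ∀ {w} → VertexOf D τ w → (∃ λ g → g ∈ τ × tgt D g ≡ w) × (∃ λ g → g ∈ τ × src D g ≡ w)
    degrees w∈ with vertex w∈
    ... | inj₁ refl = (f , y∈p∪⁅y⁆ , tf≡se) , (e , e∈τ , refl)
    ... | inj₂ refl = (e , e∈τ , refl) , (f , y∈p∪⁅y⁆ , sf≡te)

-- Coordinates around a cycle

CyclicSucc : ℕ → ℕ → ℕ → Set
CyclicSucc n i j = suc i ≡ j ⊎ (suc i ≡ n × j ≡ 0)

cyclicSucc? : ∀ n i j → Dec (CyclicSucc n i j)
cyclicSucc? n i j = suc i ≟ j ⊎-dec suc i ≟ n ×-dec j ≟ 0

CyclicAdj : ℕ → ℕ → ℕ → Set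
CyclicAdj n i j = CyclicSucc n i j ⊎ CyclicSucc n j i

cyclicSucc-functional : ∀ {n i j j′} → j < n → j′ < n → CyclicSucc n i j → CyclicSucc n i j′ → j ≡ j′
cyclicSucc-functional _ _ (inj₁ refl) (inj₁ refl) = refl
cyclicSucc-functional j<n _ (inj₁ refl) (inj₂ (refl , _)) = contradiction j<n (<-irrefl refl)
cyclicSucc-functional _ j′<n (inj₂ (refl , _)) (inj₁ refl) = contradiction j′<n (<-irrefl refl)
cyclicSucc-functional _ _ (inj₂ (_ , refl)) (inj₂ (_ , refl)) = refl

cyclicSucc-injective : ∀ {n i i′ j} → CyclicSucc n i j → CyclicSucc n i′ j → i ≡ i′
cyclicSucc-injective (inj₁ refl) (inj₁ 1+i′≡1+i) = sym (suc-injective 1+i′≡1+i)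
cyclicSucc-injective (inj₁ refl) (inj₂ (_ , ()))
cyclicSucc-injective (inj₂ (_ , refl)) (inj₁ ())
cyclicSucc-injective (inj₂ (1+i≡n , _)) (inj₂ (1+i′≡n , _)) = suc-injective (trans 1+i≡n (sym 1+i′≡n))

cyclicSucc-total : ∀ {n i} → i < n → ∃ λ j → j < n × CyclicSucc n i j
cyclicSucc-total {i = i} i<n with m≤n⇒m<n∨m≡n i<n
... | inj₁ 1+i<n = suc i , 1+i<n , inj₁ refl
... | inj₂ 1+i≡n = 0 , ≤-<-trans z≤n i<n , inj₂ (1+i≡n , refl)

cycle-induction : ∀ {ℓ} (P : ℕ → Set ℓ) {n} → (∀ {i j} → i < n → j < n → CyclicSucc n i j → P i → P j) →
  ∀ {i} → i < n → P i → ∀ {j} → j < n → P j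
cycle-induction P {suc n′} step {i} i<n Pi k<n =
  upward z≤n k<n (step ≤-refl (s≤s z≤n) (inj₂ (refl , refl)) (upward (≤-pred i<n) ≤-refl Pi))
  where
  upward : ∀ {i j} → i ≤ j → j < suc n′ → P i → P j
  upward {j = zero} z≤n _ Pi = Pi
  upward {i} {suc j} i≤1+j 1+j<n Pi with m≤n⇒m<n∨m≡n i≤1+j
  ... | inj₂ refl = Pi
  ... | inj₁ i<1+j = step j<n 1+j<n (inj₁ refl) (upward (≤-pred i<1+j) j<n Pi)
    where
    j<n : j < suc n′
    j<n = <-trans (n<1+n j) 1+j<n

cyclicSucc-irreversible : ∀ {n i j} → 3 ≤ n → CyclicSucc n i j → suc j ≢ i
cyclicSucc-irreversible _ (inj₁ refl) 2+i≡i = 1+n≰n (≤-trans (≤-reflexive 2+i≡i) (n≤1+n _))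
cyclicSucc-irreversible 3≤n (inj₂ (1+i≡n , refl)) refl =
  contradiction (subst (3 ≤_) (sym 1+i≡n) 3≤n) λ { (s≤s (s≤s ())) }

cyclicSucc-source< : ∀ {n i j} → j < n → CyclicSucc n i j → i < n
cyclicSucc-source< j<n (inj₁ refl) = <-trans (n<1+n _) j<n
cyclicSucc-source< _ (inj₂ (refl , _)) = n<1+n _

record CycleSymmetry (n : ℕ) (f : ℕ → ℕ) : Set where
  field
    bounded : ∀ {i} → i < n → f i < n
    injective : ∀ {i j} → i < n → j < n → f i ≡ f j → i ≡ j
    adjacent : ∀ {i j} → i < n → j < n → CyclicAdj n i j → CyclicAdj n (f i) (f j)

cyclicPred : ℕ → ℕ → ℕ
cyclicPred n zero = pred n
cyclicPred n (suc k) = k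

cyclicPred-succ : ∀ {n k} → k < n → CyclicSucc n (cyclicPred n k) k
cyclicPred-succ {suc _} {zero} _ = inj₂ (refl , refl)
cyclicPred-succ {k = suc _} _ = inj₁ refl

cyclicPred-symmetry : ∀ n → CycleSymmetry n (cyclicPred n)
cyclicPred-symmetry n = record
  { bounded = λ i<n → cyclicSucc-source< i<n (cyclicPred-succ i<n)
  ; injective = λ i<n j<n pi≡pj →
      cyclicSucc-functional i<n j<n (cyclicPred-succ i<n)
        (subst (λ p → CyclicSucc n p _) (sym pi≡pj) (cyclicPred-succ j<n))
  ; adjacent = λ i<n j<n → Sum.map (preserves i<n j<n) (preserves j<n i<n)
  }
  where
  preserves : ∀ {i j} → i < n → j < n → CyclicSucc n i j → CyclicSucc n (cyclicPred n i) (cyclicPred n j)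
  preserves i<n j<n i↦j =
    subst (CyclicSucc n _) (cyclicSucc-injective i↦j (cyclicPred-succ j<n)) (cyclicPred-succ i<n)

mirror-reverses : ∀ {n i j} → j < n → CyclicSucc n i j → CyclicSucc n (pred n ∸ j) (pred n ∸ i)
mirror-reverses {suc _} j<n (inj₁ refl) = inj₁ (sym (+-∸-assoc 1 (≤-pred j<n)))
mirror-reverses {suc n′} _ (inj₂ (refl , refl)) = inj₂ (refl , n∸n≡0 n′)

mirror-symmetry : ∀ n → CycleSymmetry n (pred n ∸_)
mirror-symmetry n = record
  { bounded = λ {i} i<n → ≤-<-trans (m∸n≤m (pred n) i) (pred<n i<n)
  ; injective = λ i<n j<n → ∸-cancelˡ-≡ (suc[m]≤n⇒m≤pred[n] i<n) (suc[m]≤n⇒m≤pred[n] j<n)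
  ; adjacent = λ i<n j<n → Sum.swap ∘ Sum.map (mirror-reverses j<n) (mirror-reverses i<n)
  }
  where
  pred<n : ∀ {i n} → i < n → pred n < n
  pred<n {n = suc _} _ = ≤-refl

record CycleCoordinates (D : Multidigraph) : Set where
  field
    coord : Fin (nv D) → ℕ
    coord<n : ∀ x → coord x < nv D
    coord-injective : ∀ {x y} → coord x ≡ coord y → x ≡ y
    coord-adjacent : ∀ {x y} → Adjacent D x y → CyclicAdj (nv D) (coord x) (coord y)

open CycleCoordinates

module _ {D : Multidigraph} where

  permutation-coordinates : (π : Permutation′ (nv D)) →
    (∀ u v → Adjacent D u v → CycAdj (nv D) (π ⟨$⟩ʳ u) (π ⟨$⟩ʳ v)) → CycleCoordinates D
  permutation-coordinates π adjacent = record
    { coord = toℕ ∘ (π ⟨$⟩ʳ_)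
    ; coord<n = toℕ<n ∘ (π ⟨$⟩ʳ_)
    ; coord-injective = λ πx≡πy →
        trans (sym (inverseˡ π)) (trans (cong (π ⟨$⟩ˡ_) (toℕ-injective πx≡πy)) (inverseˡ π))
    ; coord-adjacent = adjacent _ _
    }

  recoordinatise : ∀ {f} → CycleSymmetry (nv D) f → CycleCoordinates D → CycleCoordinates D
  recoordinatise {f} S C = record
    { coord = f ∘ coord C
    ; coord<n = bounded ∘ coord<n C
    ; coord-injective = coord-injective C ∘ injective (coord<n C _) (coord<n C _)
    ; coord-adjacent = adjacent (coord<n C _) (coord<n C _) ∘ coord-adjacent C
    }
    where open CycleSymmetry S

  centred-at : ∀ a → CycleCoordinates D → ∃ λ C → coord C a ≡ 0
  centred-at a C = go (coord C a) C refl
    where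
    go : ∀ k C → coord C a ≡ k → ∃ λ C → coord C a ≡ 0
    go zero C ca≡0 = C , ca≡0
    go (suc k) C ca≡1+k = go k (recoordinatise (cyclicPred-symmetry (nv D)) C) (cong (cyclicPred (nv D)) ca≡1+k)

  -- Rotating a to 0 puts b at 1 or at n − 1; in the first case one more rotation and a reflection swap them.
  normalised : ∀ {a b} → 3 ≤ nv D → Adjacent D a b → CycleCoordinates D →
    ∃ λ C → coord C a ≡ 0 × suc (coord C b) ≡ nv D
  normalised {a} 3≤n adj C₀ with centred-at a C₀
  ... | C , ca≡0 with coord-adjacent C adj
  ... | inj₂ (inj₂ (1+cb≡n , _)) = C , ca≡0 , 1+cb≡n
  ... | inj₂ (inj₁ 1+cb≡ca) = contradiction (trans 1+cb≡ca ca≡0) λ ()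
  ... | inj₁ (inj₂ (1+ca≡n , _)) =
    contradiction (subst (3 ≤_) (sym (trans (cong suc (sym ca≡0)) 1+ca≡n)) 3≤n) λ { (s≤s ()) }
  ... | inj₁ (inj₁ 1+ca≡cb) =
    recoordinatise (mirror-symmetry n) (recoordinatise (cyclicPred-symmetry n) C) ,
    trans (cong (λ k → pred n ∸ cyclicPred n k) ca≡0) (n∸n≡0 (pred n)) ,
    trans (cong (λ k → suc (pred n ∸ cyclicPred n k)) (trans (sym 1+ca≡cb) (cong suc ca≡0))) (suc-pred 3≤n)
    where
    n : ℕ
    n = nv D
    suc-pred : ∀ {n} → 3 ≤ n → suc (pred n) ≡ n
    suc-pred (s≤s _) = refl

-- Directed forests of a cycle

module CycleBlocks (D : Multidigraph) (C : CycleCoordinates D) (3≤n : 3 ≤ nv D)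
  (no-arc-0→last : ∀ e → coord C (src D e) ≡ 0 → suc (coord C (tgt D e)) ≡ nv D → ⊥) where

  n : ℕ
  n = nv D

  sc tc : Fin (ne D) → ℕ
  sc e = coord C (src D e)
  tc e = coord C (tgt D e)

  Forward : Fin (ne D) → Set
  Forward e = CyclicSucc n (sc e) (tc e)

  forward? : Decidable Forward
  forward? e = cyclicSucc? n (sc e) (tc e)

  Backward : Fin (ne D) → Set
  Backward e = suc (tc e) ≡ sc e

  arcBlock : ℕ → ℕ → ℕ
  arcBlock i j with cyclicSucc? n i j
  ... | yes _ = 2 * j
  ... | no _ = suc (2 * j)

  block : Fin (ne D) → ℕ
  block e = arcBlock (sc e) (tc e)

  open Blocks block

  nonloop? : Decidable (λ e → src D e ≢ tgt D e)
  nonloop? e = ¬? (src D e ≟ᶠ tgt D e)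

  Nonloop : Subset (ne D)
  Nonloop = select nonloop?

  evens : List ℕ
  evens = applyUpTo (2 *_) n

  block-forward : ∀ {e} → Forward e → block e ≡ 2 * tc e
  block-forward {e} fw with forward? e
  ... | yes _ = refl
  ... | no ¬fw = contradiction fw ¬fw

  block-backward : ∀ {e} → Backward e → block e ≡ suc (2 * tc e)
  block-backward {e} bw with forward? e
  ... | yes fw = contradiction bw (cyclicSucc-irreversible 3≤n fw)
  ... | no _ = refl

  data Direction (e : Fin (ne D)) : Set where
    forward : Forward e → block e ≡ 2 * tc e → Direction e
    backward : Backward e → block e ≡ suc (2 * tc e) → Direction e

  direction : ∀ {e} → e ∈ Nonloop → Direction e
  direction {e} e∈N with coord-adjacent C (∈-select⁻ nonloop? e∈N , e , inj₁ (refl , refl))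
  ... | inj₁ fw = forward fw (block-forward fw)
  ... | inj₂ (inj₁ bw) = backward bw (block-backward bw)
  ... | inj₂ (inj₂ (1+tc≡n , sc≡0)) = ⊥-elim (no-arc-0→last e sc≡0 1+tc≡n)

  parity : ∀ {e} → Direction e → block e ≡ 2 * tc e ⊎ block e ≡ suc (2 * tc e)
  parity (forward _ be) = inj₁ be
  parity (backward _ be) = inj₂ be

  same-target-close : ∀ {e f} → e ∈ Nonloop → f ∈ Nonloop → tgt D e ≡ tgt D f → Close (block e) (block f)
  same-target-close {f = f} e∈N f∈N te≡tf =
    same-pair-close (parity (direction e∈N))
      (subst (λ t → block f ≡ 2 * t ⊎ block f ≡ suc (2 * t)) (cong (coord C) (sym te≡tf))
        (parity (direction f∈N)))

  evens-sparse : Sparse evens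
  evens-sparse j∈ 1+j∈ with ∈-applyUpTo⁻ (2 *_) j∈ | ∈-applyUpTo⁻ (2 *_) 1+j∈
  ... | a , _ , refl | b , _ , 1+2a≡2b = even≢odd b a (sym 1+2a≡2b)

  nonloop-flanked : Flanked Nonloop evens
  nonloop-flanked {e} e∈N be∉evens with direction e∈N
  ... | forward _ be = contradiction (subst (_∈ₗ evens) (sym be) (∈-applyUpTo⁺ (2 *_) (coord<n C _))) be∉evens
  ... | backward bw be =
    2 * tc e , be , ∈-applyUpTo⁺ (2 *_) (coord<n C _) ,
    subst (_∈ₗ evens) (*-suc 2 (tc e)) (∈-applyUpTo⁺ (2 *_) (subst (_< n) (sym bw) (coord<n C _)))

  -- The arc leaving the target t of a backward arc is either forward, landing in block 2t + 2 next to 2t + 1,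
  -- or backward into t − 1; the latter cannot go on forever.
  cycle-forward : ∀ {σ τ} → Independent Nonloop σ → τ ⊆ σ → DirectedCycle D τ → ∀ {e} → e ∈ τ → Forward e
  cycle-forward {σ} {τ} (σ⊆N , sep) τ⊆σ cycle {e} e∈τ with direction (σ⊆N (τ⊆σ e∈τ))
  ... | forward fw _ = fw
  ... | backward bw be = ⊥-elim (descend (tc e) e∈τ bw be refl)
    where
    descend : ∀ t {e} → e ∈ τ → Backward e → block e ≡ suc (2 * tc e) → tc e ≡ t → ⊥
    descend t {e} e∈τ bw be te≡t with directedCycle-out D cycle e∈τ
    ... | g , g∈τ , sg≡te with cong (coord C) sg≡te | direction (σ⊆N (τ⊆σ g∈τ))
    ...   | scg≡te | forward (inj₁ 1+sg≡tg) bg =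
      sep (τ⊆σ e∈τ) (τ⊆σ g∈τ) (λ where refl → cyclicSucc-irreversible 3≤n (inj₁ 1+sg≡tg) bw)
        (inj₂ (inj₁ (begin
        suc (block e)           ≡⟨ cong suc be ⟩
        suc (suc (2 * tc e))    ≡⟨ *-suc 2 (tc e) ⟨
        2 * suc (tc e)          ≡⟨ cong (λ t → 2 * suc t) scg≡te ⟨
        2 * suc (sc g)          ≡⟨ cong (2 *_) 1+sg≡tg ⟩
        2 * tc g                ≡⟨ bg ⟨
        block g                 ∎)))
    ...   | scg≡te | forward (inj₂ (1+sg≡n , _)) _ =
      <-irrefl (trans (cong suc (sym scg≡te)) 1+sg≡n) (subst (_< n) (sym bw) (coord<n C _))
    ...   | scg≡te | backward bwg bg with t
    ...     | zero = contradiction (trans bwg (trans scg≡te te≡t)) λ ()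
    ...     | suc t′ = descend t′ g∈τ bwg bg (suc-injective (trans bwg (trans scg≡te te≡t)))

  forward-cycle-hits : ∀ {τ} → DirectedCycle D τ → (∀ {e} → e ∈ τ → Forward e) →
    ∀ {k} → k < n → ∃ λ g → g ∈ τ × tc g ≡ k
  forward-cycle-hits {τ} cycle@((e₀ , e₀∈τ) , _) allForward =
    cycle-induction (λ k → ∃ λ g → g ∈ τ × tc g ≡ k) step (coord<n C _) (e₀ , e₀∈τ , refl)
    where
    step : ∀ {i j} → i < n → j < n → CyclicSucc n i j →
      ∃ (λ g → g ∈ τ × tc g ≡ i) → ∃ λ g → g ∈ τ × tc g ≡ j
    step _ j<n i↦j (e , e∈τ , te≡i) with directedCycle-out D cycle e∈τ
    ... | g , g∈τ , sg≡te =
      g , g∈τ ,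
      cyclicSucc-functional (coord<n C _) j<n
        (subst (λ s → CyclicSucc n s (tc g)) (trans (cong (coord C) sg≡te) te≡i) (allForward g∈τ)) i↦j

  nonCovering⇒forest : ∀ {σ} → NonCovering Nonloop evens σ → DirectedForest D σ
  nonCovering⇒forest {σ} (ind@(σ⊆N , sep) , j , j∈evens , ¬hit) = noParallel , acyclic , indegree
    where
    noParallel : NoParallel D σ
    noParallel e f e∈σ f∈σ e≢f (se≡sf , te≡tf) =
      sep e∈σ f∈σ e≢f (inj₁ (cong₂ arcBlock (cong (coord C) se≡sf) (cong (coord C) te≡tf)))
    indegree : ∀ e f → e ∈ σ → f ∈ σ → e ≢ f → tgt D e ≢ tgt D f
    indegree e f e∈σ f∈σ e≢f = sep e∈σ f∈σ e≢f ∘ same-target-close (σ⊆N e∈σ) (σ⊆N f∈σ)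
    acyclic : ¬ ∃ λ τ → τ ⊆ σ × DirectedCycle D τ
    acyclic (τ , τ⊆σ , cycle) =
      let k , k<n , j≡2k = ∈-applyUpTo⁻ (2 *_) j∈evens
          allForward = cycle-forward ind τ⊆σ cycle
          g , g∈τ , tg≡k = forward-cycle-hits cycle allForward k<n
      in ¬hit (g , τ⊆σ g∈τ , trans (block-forward (allForward g∈τ)) (trans (cong (2 *_) tg≡k) (sym j≡2k)))

  -- If σ hits every even block then every vertex is the target of a forward arc of σ,
  -- and these arcs form a directed cycle.
  module ForwardArcs {σ} (σ⊆N : σ ⊆ Nonloop)
    (indegree : ∀ e f → e ∈ σ → f ∈ σ → e ≢ f → tgt D e ≢ tgt D f)
    (hits : ∀ {j} → j ∈ₗ evens → Hit σ j) where

    forward-into : ∀ {k} → k < n → ∃ λ g → g ∈ σ × Forward g × tc g ≡ k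
    forward-into {k} k<n with hits (∈-applyUpTo⁺ (2 *_) k<n)
    ... | g , g∈σ , bg≡2k with direction (σ⊆N g∈σ)
    ...   | forward fw bg = g , g∈σ , fw , *-cancelˡ-≡ (tc g) k 2 (trans (sym bg) bg≡2k)
    ...   | backward _ bg = contradiction (trans (sym bg≡2k) bg) (even≢odd k (tc g))

    arcs : Subset (ne D)
    arcs = σ ∩ select forward?

    arcs⊆σ : arcs ⊆ σ
    arcs⊆σ = proj₁ ∘ x∈p∩q⁻ σ _

    arcs-forward : ∀ {e} → e ∈ arcs → Forward e
    arcs-forward = ∈-select⁻ forward? ∘ proj₂ ∘ x∈p∩q⁻ σ _

    into : ∀ w → ∃ λ g → g ∈ arcs × tgt D g ≡ w
    into w =
      let g , g∈σ , fw , tg≡cw = forward-into (coord<n C w)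
      in g , x∈p∩q⁺ (g∈σ , ∈-select⁺ forward? fw) , coord-injective C tg≡cw

    out-of : ∀ w → ∃ λ g → g ∈ arcs × src D g ≡ w
    out-of w =
      let j , j<n , w↦j = cyclicSucc-total (coord<n C w)
          g , g∈σ , fw , tg≡j = forward-into j<n
      in g , x∈p∩q⁺ (g∈σ , ∈-select⁺ forward? fw) ,
         coord-injective C (cyclicSucc-injective (subst (CyclicSucc n (sc g)) tg≡j fw) w↦j)

    tgt-injective : ∀ {e f} → e ∈ arcs → f ∈ arcs → tgt D e ≡ tgt D f → e ≡ f
    tgt-injective {e} {f} e∈ f∈ te≡tf with e ≟ᶠ f
    ... | yes e≡f = e≡f
    ... | no e≢f = contradiction te≡tf (indegree e f (arcs⊆σ e∈) (arcs⊆σ f∈) e≢f)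

    src-injective : ∀ {e f} → e ∈ arcs → f ∈ arcs → src D e ≡ src D f → e ≡ f
    src-injective {f = f} e∈ f∈ se≡sf =
      tgt-injective e∈ f∈ (coord-injective C (cyclicSucc-functional (coord<n C _) (coord<n C _) (arcs-forward e∈)
        (subst (λ s → CyclicSucc n s (tc f)) (cong (coord C) (sym se≡sf)) (arcs-forward f∈))))

    reach : ∀ x₀ x → Conn D arcs x₀ x
    reach x₀ x =
      cycle-induction (λ i → ∀ {x} → coord C x ≡ i → Conn D arcs x₀ x) step (coord<n C x₀) base (coord<n C x) refl
      where
      base : ∀ {x} → coord C x ≡ coord C x₀ → Conn D arcs x₀ x
      base cx≡cx₀ = subst (Conn D arcs x₀) (coord-injective C (sym cx≡cx₀)) here
      step : ∀ {i j} → i < n → j < n → CyclicSucc n i j →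
        (∀ {x} → coord C x ≡ i → Conn D arcs x₀ x) → ∀ {x} → coord C x ≡ j → Conn D arcs x₀ x
      step _ _ i↦j reach-i {x} cx≡j =
        let g , g∈ , tg≡x = into x
            sg≡i = cyclicSucc-injective
                     (subst (CyclicSucc n (sc g)) (trans (cong (coord C) tg≡x) cx≡j) (arcs-forward g∈)) i↦j
        in subst (Conn D arcs x₀) tg≡x (conn-trans D (reach-i sg≡i) (conn-edge D g∈))

    arcs-cycle : DirectedCycle D arcs
    arcs-cycle =
      directedCycle-intro D vertex₀ (let g , g∈ , _ = into vertex₀ in g , g∈) (λ {x} _ → reach vertex₀ x)
        tgt-injective src-injective λ {w} _ → into w , out-of w
      where
      vertex₀ : Fin n
      vertex₀ = fromℕ< (≤-trans (s≤s z≤n) 3≤n)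

  module Forest {σ} (forest : DirectedForest D σ) where

    acyclic : ¬ ∃ λ τ → τ ⊆ σ × DirectedCycle D τ
    acyclic = proj₁ (proj₂ forest)

    indegree : ∀ e f → e ∈ σ → f ∈ σ → e ≢ f → tgt D e ≢ tgt D f
    indegree = proj₂ (proj₂ forest)

    σ⊆N : σ ⊆ Nonloop
    σ⊆N e∈σ = ∈-select⁺ nonloop? λ loop → acyclic (_ , x∈p⇒⁅x⁆⊆p e∈σ , loop-directedCycle D loop)

    different-targets : ∀ {e f} → e ∈ σ → f ∈ σ → e ≢ f → tc e ≢ tc f
    different-targets e∈σ f∈σ e≢f = indegree _ _ e∈σ f∈σ e≢f ∘ coord-injective C

    equal-blocks : ∀ {e f} → e ∈ σ → f ∈ σ → e ≢ f → block e ≢ block f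
    equal-blocks {e} {f} e∈σ f∈σ e≢f be≡bf with direction (σ⊆N e∈σ) | direction (σ⊆N f∈σ)
    ... | forward _ be | forward _ bf =
      different-targets e∈σ f∈σ e≢f (*-cancelˡ-≡ (tc e) (tc f) 2 (trans (sym be) (trans be≡bf bf)))
    ... | backward _ be | backward _ bf =
      different-targets e∈σ f∈σ e≢f (*-cancelˡ-≡ (tc e) (tc f) 2 (suc-injective (trans (sym be) (trans be≡bf bf))))
    ... | forward _ be | backward _ bf = even≢odd (tc e) (tc f) (trans (sym be) (trans be≡bf bf))
    ... | backward _ be | forward _ bf = even≢odd (tc f) (tc e) (trans (sym bf) (trans (sym be≡bf) be))

    consecutive-blocks : ∀ {e f} → e ∈ σ → f ∈ σ → e ≢ f → suc (block e) ≢ block f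
    consecutive-blocks {e} {f} e∈σ f∈σ e≢f 1+be≡bf with direction (σ⊆N e∈σ) | direction (σ⊆N f∈σ)
    ... | forward _ be | forward _ bf = even≢odd (tc f) (tc e) (trans (sym bf) (trans (sym 1+be≡bf) (cong suc be)))
    ... | forward _ be | backward _ bf =
      different-targets e∈σ f∈σ e≢f
        (*-cancelˡ-≡ (tc e) (tc f) 2 (suc-injective (trans (cong suc (sym be)) (trans 1+be≡bf bf))))
    ... | backward _ be | backward _ bf =
      even≢odd (suc (tc e)) (tc f) (trans (*-suc 2 (tc e)) (trans (cong suc (sym be)) (trans 1+be≡bf bf)))
    ... | backward bw be | forward fw bf =
      acyclic (_ , p∪⁅y⁆⊆q (x∈p⇒⁅x⁆⊆p e∈σ) f∈σ ,
        antiparallel-directedCycle D (∈-select⁻ nonloop? (σ⊆N e∈σ))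
          (coord-injective C sf≡te) (coord-injective C tf≡se))
      where
      tf≡1+te : tc f ≡ suc (tc e)
      tf≡1+te = *-cancelˡ-≡ (tc f) (suc (tc e)) 2 (begin
        2 * tc f              ≡⟨ bf ⟨
        block f               ≡⟨ 1+be≡bf ⟨
        suc (block e)         ≡⟨ cong suc be ⟩
        suc (suc (2 * tc e))  ≡⟨ *-suc 2 (tc e) ⟨
        2 * suc (tc e)        ∎)
      sf≡te : sc f ≡ tc e
      sf≡te = cyclicSucc-injective (subst (CyclicSucc n (sc f)) tf≡1+te fw) (inj₁ refl)
      tf≡se : tc f ≡ sc e
      tf≡se = trans tf≡1+te bw

    separated : Separated σ
    separated e∈σ f∈σ e≢f (inj₁ be≡bf) = equal-blocks e∈σ f∈σ e≢f be≡bf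
    separated e∈σ f∈σ e≢f (inj₂ (inj₁ 1+be≡bf)) = consecutive-blocks e∈σ f∈σ e≢f 1+be≡bf
    separated e∈σ f∈σ e≢f (inj₂ (inj₂ 1+bf≡be)) = consecutive-blocks f∈σ e∈σ (e≢f ∘ sym) 1+bf≡be

    misses : Misses σ evens
    misses with misses? σ evens
    ... | yes miss = miss
    ... | no ¬miss = ⊥-elim (acyclic (arcs , arcs⊆σ , arcs-cycle))
      where open ForwardArcs σ⊆N indegree (¬misses⇒hit ¬miss)

  forest⇒nonCovering : ∀ {σ} → DirectedForest D σ → NonCovering Nonloop evens σ
  forest⇒nonCovering forest = (σ⊆N , separated) , misses
    where open Forest forest

  dt≐nonCovering : DT D ≐ NonCovering Nonloop evens
  dt≐nonCovering = forest⇒nonCovering , nonCovering⇒forest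

  dt-vertexDecomposable : VertexDecomposable (DT D)
  dt-vertexDecomposable =
    vertexDecomposable-resp-≐ (≐-sym dt≐nonCovering) (nonCovering-vertexDecomposable Nonloop evens evens-sparse nonloop-flanked)

proposition4p5 : (D : Multidigraph) → UnderlyingIsCycle D →
    (∃ λ u → ∃ λ v → Adjacent D u v ×
      ((¬ ∃ λ e → src D e ≡ u × tgt D e ≡ v) ⊎ (¬ ∃ λ e → src D e ≡ v × tgt D e ≡ u))) →
    VertexDecomposable (DT D)
proposition4p5 D (3≤n , π , adjacency) (u , v , adj , missing) =
  let a , b , adj′ , no-a→b = oriented-gap D adj missing
      C , ca≡0 , 1+cb≡n = normalised 3≤n adj′ (permutation-coordinates π (λ x y → proj₁ (adjacency x y)))
  in CycleBlocks.dt-vertexDecomposable D C 3≤n λ e se≡0 1+te≡n →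
       no-a→b (e , coord-injective C (trans se≡0 (sym ca≡0)) ,
                   coord-injective C (suc-injective (trans 1+te≡n (sym 1+cb≡n))))
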